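{- Let $A$ be a finite abelian group and $B$ a subgroup of $A$ of index $2$. The number of subsets $S\subseteq A\setminus B$ with $S=S^{ -1}$ and $\langle S\rangle$ a proper subgroup of $A$ is at most $2^{\frac{|A|}{8}+\frac{|A_2\setminus B|}{2}+\log_2|A|}$.
   Context: $A_2:=\{a\in A\mid a^2=1\}$; $S^{ -1}:=\{s^{ -1}\mid s\in S\}$. -}

module Defs where

open import Data.Nat using (ℕ; _≤_; _*_; _+_; _^_)
open import Data.Fin using (Fin)
open import Data.Fin.Properties using (_≟_)
open import Data.Fin.Subset using (Subset; _∈_; _∉_; _⊆_; ∣_∣)
open import Data.Fin.Subset.Properties using (_∈?_)
open import Data.Vec using (tabulate)
open import Data.Bool using (_∧_; not)
open import Data.List using (List; length)
open import Data.List.Relation.Unary.All using (All)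
open import Data.List.Relation.Unary.Unique.Propositional using (Unique)
open import Data.Product using (_×_)
open import Algebra.Structures using (IsAbelianGroup)
open import Relation.Binary.PropositionalEquality using (_≡_)
open import Relation.Nullary using (¬_; does)
open import Function.Bundles using (_⇔_)

-- A finite abelian group of order n, with carrier Fin n
-- (every finite abelian group is isomorphic to one of these).
record FinAbGroup (n : ℕ) : Set where
  field
    _·_ : Fin n → Fin n → Fin n
    ε   : Fin n
    _⁻¹ : Fin n → Fin n
    isAbelianGroup : IsAbelianGroup _≡_ _·_ ε _⁻¹

module _ {n : ℕ} (G : FinAbGroup n) where
  open FinAbGroup G

  IsSubgroup : Subset n → Set
  IsSubgroup H = (ε ∈ H)
               × (∀ a b → a ∈ H → b ∈ H → (a · b) ∈ H)
               × (∀ a → a ∈ H → (a ⁻¹) ∈ H)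

  IsIndexTwoSubgroup : Subset n → Set
  IsIndexTwoSubgroup B = IsSubgroup B × (2 * ∣ B ∣ ≡ n)

  _∈⟨_⟩ : Fin n → Subset n → Set
  a ∈⟨ S ⟩ = ∀ (H : Subset n) → IsSubgroup H → S ⊆ H → a ∈ H

  GenProper : Subset n → Set
  GenProper S = ¬ (∀ a → a ∈⟨ S ⟩)

  Symmetric : Subset n → Set
  Symmetric S = ∀ a → (a ∈ S) ⇔ ((a ⁻¹) ∈ S)

  Counted : Subset n → Subset n → Set
  Counted B S = (∀ a → a ∈ S → a ∉ B) × Symmetric S × GenProper S

  A₂∖ : Subset n → Subset n
  A₂∖ B = tabulate (λ a → does ((a · a) ≟ ε) ∧ not (does (a ∈? B)))

module Submission where

-- A counted S generates a proper subgroup, so S ⊆ M ∩ ∁ B for some maximal subgroup M.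
-- Two distinct maximal subgroups M, M′ of an abelian group satisfy MM′ = A, hence
-- n ∣M ∩ M′∣ = ∣M∣ ∣M′∣: the vectors n 1_M − ∣M∣ 1_A in ℤ^A are pairwise orthogonal, and
-- comparing the square of their sum at ε with its norm shows there are at most n of them.
-- For a fixed M, translating by an element of T = M ∩ ∁ B maps T into M ∩ B, so 4∣T∣ ≤ n;
-- a symmetric S ⊆ T is determined by its intersection with a set of representatives of the
-- pairs {x, x⁻¹} ⊆ T, and there are at most (∣T∣ + ∣A₂ ∖ B∣)/2 such representatives.

open import Defs

open import Level using (0ℓ)
open import Function using (_∘_; id; case_of_; _⇔_; Equivalence)
open import Data.Empty using (⊥)
import Data.Unit as Unit
open import Data.Product using (_×_; _,_; proj₁; proj₂; ∃)
import Data.Product as Product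
open import Data.Sum using (inj₁; inj₂)
open import Data.Bool using (Bool; true; false)
import Data.Bool as Bool

open import Data.Nat using (NonZero; ℕ; zero; suc; _≤_; _*_; _+_; _^_; _/_; _≤?_; z≤n; s≤s)
open import Data.Nat.Properties hiding (_≟_)
open import Data.Nat.DivMod using (m*n/n≡m; /-monoˡ-≤; m/n*n≤m)
open import Data.Nat.ListAction using (sum)
open import Data.Nat.Tactic.RingSolver using () renaming (solve-∀ to solve-∀ℕ)
open import Data.Integer as ℤ using (ℤ; -_)
  renaming (_+_ to _+ᶻ_; _*_ to _*ᶻ_; _-_ to _-ᶻ_; _≤_ to _≤ᶻ_)
import Data.Integer.Properties as ℤ
open import Data.Integer.Tactic.RingSolver using (solve-∀)

open import Data.Fin using (Fin; zero; suc; toℕ)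
open import Data.Fin.Properties using (_≟_; toℕ-injective; nonZeroIndex; all?; any?)
open import Data.Fin.Permutation using (Permutation′; _⟨$⟩ʳ_; permutation)
open import Data.Fin.Subset using (Subset; _∈_; _∉_; _⊆_; _⊂_; _⊃_; ∣_∣; _∩_; _∪_; ∁; ⊤; ⁅_⁆)
open import Data.Fin.Subset.Properties
  using (_∈?_; _⊆?_; _⊂?_; nonempty?; anySubset?; ⊆-antisym; drop-∷-⊆; x∈p∩q⁺; x∈p∩q⁻; x∉p⇒x∈∁p; x∈∁p⇒x∉p;
         p⊆p∪q; x∈p∪q⁺; x∈p∪q⁻; x∈⁅x⁆; x∈⁅y⁆⇒x≡y; ∈⊤; ∩-identityˡ; ∩-identityʳ; ∩-idem; Empty-unique;
         ∣p∣≤n; ∣∁p∣≡n∸∣p∣; ∣⊤∣≡n; ∣⊥∣≡0; p⊆q⇒∣p∣≤∣q∣; p⊂q⇒∣p∣<∣q∣)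
open import Data.Fin.Subset.Induction using (⊃-wellFounded; acc; Acc)
open import Data.Vec using ([]; _∷_; here; there; tabulate)
open import Data.Vec.Properties using (lookup∘tabulate; lookup⇒[]=; []=⇒lookup; ≡-dec)

open import Data.List using (List; []; _∷_; length; map; filter; deduplicate)
open import Data.List.Properties using (length-map)
open import Data.List.Relation.Unary.All as All using (All; []; _∷_)
import Data.List.Relation.Unary.All.Properties as All
open import Data.List.Relation.Unary.All.Properties using (all-filter)
open import Data.List.Relation.Unary.Any as Any using (Any)
import Data.List.Relation.Unary.Any.Properties as Any
open import Data.List.Relation.Unary.AllPairs using (AllPairs; []; _∷_)
import Data.List.Relation.Unary.AllPairs.Properties as AllPairs
open import Data.List.Relation.Unary.Unique.Propositional using (Unique)
import Data.List.Relation.Unary.Unique.Propositional.Properties as Unique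
open import Data.List.Relation.Unary.Unique.DecPropositional.Properties using (deduplicate-!)
open import Data.List.Relation.Binary.Sublist.Propositional.Properties using (filter-⊆; filter⁺; length-mono-≤)

open import Relation.Unary using (Pred; Decidable)
open import Relation.Unary.Properties using (∁?)
open import Relation.Binary.Definitions using (DecidableEquality)
open import Relation.Binary.PropositionalEquality
open import Relation.Nullary using (yes; no; does; contradiction; ¬?; _×-dec_; _→-dec_)
open import Relation.Nullary.Decidable using (dec-true)

open import Algebra.Bundles using (AbelianGroup)
open import Algebra.Structures using (IsAbelianGroup)
import Algebra.Properties.Group as GroupProperties
import Algebra.Properties.CommutativeMonoid.Sum as CommutativeMonoidSum
import Algebra.Properties.Semiring.Sum as SemiringSum

open CommutativeMonoidSum +-0-commutativeMonoid using (sum-cong-≗; ∑-distrib-+; ∑-comm)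
  renaming (sum to ∑; sum-permute to ∑-permute)
open SemiringSum +-*-semiring using () renaming (*-distribˡ-sum to *-distribˡ-∑; *-distribʳ-sum to *-distribʳ-∑)
open CommutativeMonoidSum ℤ.+-0-commutativeMonoid using ()
  renaming (sum to ∑ᶻ; sum-cong-≗ to ∑ᶻ-cong; ∑-distrib-+ to ∑ᶻ-distrib-+; sum-replicate-zero to ∑ᶻ-zero)
open SemiringSum ℤ.+-*-semiring using () renaming (*-distribˡ-sum to *ᶻ-distribˡ-∑ᶻ)

-- Arithmetic, finite sums and cardinalities of subsets

^-distribʳ-* : ∀ a b k → (a * b) ^ k ≡ a ^ k * b ^ k
^-distribʳ-* a b zero    = refl
^-distribʳ-* a b (suc k) = trans (cong ((a * b) *_) (^-distribʳ-* a b k)) (interchange a b (a ^ k) (b ^ k))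
  where
  interchange : ∀ a b x y → (a * b) * (x * y) ≡ (a * x) * (b * y)
  interchange = solve-∀ℕ

q²≤d∧2d≤n²q∧mn≤2q⇒m≤n : ∀ {m n q d} .{{_ : NonZero n}} → q * q ≤ d → 2 * d ≤ n * (n * q) → m * n ≤ 2 * q → m ≤ n
q²≤d∧2d≤n²q∧mn≤2q⇒m≤n {m} {n} {zero}  _    _     mn≤2q = ≤-trans (m≤m*n m n) (≤-trans mn≤2q z≤n)
q²≤d∧2d≤n²q∧mn≤2q⇒m≤n {m} {n} {q@(suc _)} {d} q²≤d 2d≤n²q mn≤2q = *-cancelʳ-≤ m n n (≤-trans mn≤2q 2q≤n²)
  where
  2q≤n² : 2 * q ≤ n * n
  2q≤n² = *-cancelʳ-≤ (2 * q) (n * n) q (begin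
    2 * q * q      ≡⟨ *-assoc 2 q q ⟩
    2 * (q * q)    ≤⟨ *-monoʳ-≤ 2 q²≤d ⟩
    2 * d          ≤⟨ 2d≤n²q ⟩
    n * (n * q)    ≡⟨ sym (*-assoc n n q) ⟩
    n * n * q      ∎)
    where open ≤-Reasoning

∑-mono-≤ : ∀ {m} {f g : Fin m → ℕ} → (∀ i → f i ≤ g i) → ∑ f ≤ ∑ g
∑-mono-≤ {zero}  f≤g = z≤n
∑-mono-≤ {suc m} f≤g = +-mono-≤ (f≤g zero) (∑-mono-≤ (f≤g ∘ suc))

term≤∑ : ∀ {m} (f : Fin m → ℕ) i → f i ≤ ∑ f
term≤∑ f zero    = m≤m+n (f zero) _
term≤∑ f (suc i) = ≤-trans (term≤∑ (f ∘ suc) i) (m≤n+m _ (f zero))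

∑-const : ∀ m c → ∑ {m} (λ _ → c) ≡ m * c
∑-const zero    c = refl
∑-const (suc m) c = cong (c +_) (∑-const m c)

χ : ∀ {n} → Subset n → Fin n → ℕ
χ (_     ∷ p) (suc x) = χ p x
χ (true  ∷ p) zero    = 1
χ (false ∷ p) zero    = 0

∣p∣≡∑χ : ∀ {n} (p : Subset n) → ∣ p ∣ ≡ ∑ (χ p)
∣p∣≡∑χ []          = refl
∣p∣≡∑χ (true  ∷ p) = cong suc (∣p∣≡∑χ p)
∣p∣≡∑χ (false ∷ p) = ∣p∣≡∑χ p

χ-∈ : ∀ {n} {p : Subset n} {x} → x ∈ p → χ p x ≡ 1
χ-∈ here      = refl
χ-∈ (there h) = χ-∈ h

χ-∉ : ∀ {n} {p : Subset n} {x} → x ∉ p → χ p x ≡ 0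
χ-∉ {p = _     ∷ p} {suc x} x∉p = χ-∉ (x∉p ∘ there)
χ-∉ {p = true  ∷ p} {zero}  x∉p = contradiction here x∉p
χ-∉ {p = false ∷ p} {zero}  x∉p = refl

χ-∩ : ∀ {n} (p q : Subset n) x → χ (p ∩ q) x ≡ χ p x * χ q x
χ-∩ (_     ∷ p) (_     ∷ q) (suc x) = χ-∩ p q x
χ-∩ (true  ∷ p) (true  ∷ q) zero    = refl
χ-∩ (true  ∷ p) (false ∷ q) zero    = refl
χ-∩ (false ∷ p) (_     ∷ q) zero    = refl

χ≤1 : ∀ {n} (p : Subset n) x → χ p x ≤ 1
χ≤1 p x with x ∈? p
... | yes x∈p = ≤-reflexive (χ-∈ x∈p)
... | no  x∉p = ≤-trans (≤-reflexive (χ-∉ x∉p)) z≤n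

χ-mono : ∀ {n} {p q : Subset n} {x y} → (x ∈ p → y ∈ q) → χ p x ≤ χ q y
χ-mono {p = p} {q} {x} {y} x∈p⇒y∈q with x ∈? p
... | yes x∈p = subst (_≤ χ q y) (sym (χ-∈ x∈p)) (≤-reflexive (sym (χ-∈ (x∈p⇒y∈q x∈p))))
... | no  x∉p = subst (_≤ χ q y) (sym (χ-∉ x∉p)) z≤n

χ-cong : ∀ {n} {p q : Subset n} {x y} → (x ∈ p → y ∈ q) → (y ∈ q → x ∈ p) → χ p x ≡ χ q y
χ-cong to from = ≤-antisym (χ-mono to) (χ-mono from)

χ+χ≤1 : ∀ {n} {p q : Subset n} {x y} → (x ∈ p → y ∉ q) → χ p x + χ q y ≤ 1
χ+χ≤1 {p = p} {q} {x} {y} exclusive with x ∈? p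
... | yes x∈p = ≤-reflexive (cong₂ _+_ (χ-∈ x∈p) (χ-∉ (exclusive x∈p)))
... | no  x∉p = subst (λ c → c + χ q y ≤ 1) (sym (χ-∉ x∉p)) (χ≤1 q y)

∣∣-mono-permutation : ∀ {n} {p q : Subset n} (π : Permutation′ n) → (∀ {x} → x ∈ p → π ⟨$⟩ʳ x ∈ q) → ∣ p ∣ ≤ ∣ q ∣
∣∣-mono-permutation {p = p} {q} π p⇒πq = begin
  ∣ p ∣                ≡⟨ ∣p∣≡∑χ p ⟩
  ∑ (χ p)              ≤⟨ ∑-mono-≤ (λ x → χ-mono {x = x} p⇒πq) ⟩
  ∑ (χ q ∘ (π ⟨$⟩ʳ_))  ≡⟨ sym (∑-permute (χ q) π) ⟩
  ∑ (χ q)              ≡⟨ sym (∣p∣≡∑χ q) ⟩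
  ∣ q ∣                ∎
  where open ≤-Reasoning

∣p∩∁q∣+∣p∩q∣≡∣p∣ : ∀ {n} (p q : Subset n) → ∣ p ∩ ∁ q ∣ + ∣ p ∩ q ∣ ≡ ∣ p ∣
∣p∩∁q∣+∣p∩q∣≡∣p∣ []          []          = refl
∣p∩∁q∣+∣p∩q∣≡∣p∣ (true  ∷ p) (true  ∷ q) = trans (+-suc _ _) (cong suc (∣p∩∁q∣+∣p∩q∣≡∣p∣ p q))
∣p∩∁q∣+∣p∩q∣≡∣p∣ (true  ∷ p) (false ∷ q) = cong suc (∣p∩∁q∣+∣p∩q∣≡∣p∣ p q)
∣p∩∁q∣+∣p∩q∣≡∣p∣ (false ∷ p) (_     ∷ q) = ∣p∩∁q∣+∣p∩q∣≡∣p∣ p q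

∣p∣+∣∁p∣≡n : ∀ {n} (p : Subset n) → ∣ p ∣ + ∣ ∁ p ∣ ≡ n
∣p∣+∣∁p∣≡n p = trans (cong (λ k → ∣ p ∣ + k) (∣∁p∣≡n∸∣p∣ p)) (m+[n∸m]≡n (∣p∣≤n p))

module _ {n : ℕ} (p : Subset n) (∣p∣≤∣∁p∣ : ∣ p ∣ ≤ ∣ ∁ p ∣) where

  ∣p∣≤∣∁p∣⇒2∣p∣≤n : 2 * ∣ p ∣ ≤ n
  ∣p∣≤∣∁p∣⇒2∣p∣≤n = begin
    2 * ∣ p ∣          ≡⟨ cong (λ k → ∣ p ∣ + k) (+-identityʳ ∣ p ∣) ⟩
    ∣ p ∣ + ∣ p ∣      ≤⟨ +-monoʳ-≤ ∣ p ∣ ∣p∣≤∣∁p∣ ⟩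
    ∣ p ∣ + ∣ ∁ p ∣    ≡⟨ ∣p∣+∣∁p∣≡n p ⟩
    n                  ∎
    where open ≤-Reasoning

  ∣p∣≤∣∁p∣⇒n≤2∣∁p∣ : n ≤ 2 * ∣ ∁ p ∣
  ∣p∣≤∣∁p∣⇒n≤2∣∁p∣ = begin
    n                  ≡⟨ sym (∣p∣+∣∁p∣≡n p) ⟩
    ∣ p ∣ + ∣ ∁ p ∣    ≤⟨ +-monoˡ-≤ ∣ ∁ p ∣ ∣p∣≤∣∁p∣ ⟩
    ∣ ∁ p ∣ + ∣ ∁ p ∣  ≡⟨ cong (λ k → ∣ ∁ p ∣ + k) (sym (+-identityʳ ∣ ∁ p ∣)) ⟩
    2 * ∣ ∁ p ∣        ∎
    where open ≤-Reasoning

module _ {n p} {P : Pred (Fin n) p} (P? : Decidable P) where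

  subset : Subset n
  subset = tabulate (does ∘ P?)

  ∈-subset⁺ : ∀ {x} → P x → x ∈ subset
  ∈-subset⁺ {x} Px = lookup⇒[]= x subset (trans (lookup∘tabulate (does ∘ P?) x) (dec-true (P? x) Px))

  ∈-subset⁻ : ∀ {x} → x ∈ subset → P x
  ∈-subset⁻ {x} x∈ with P? x | trans (sym (lookup∘tabulate (does ∘ P?) x)) ([]=⇒lookup x∈)
  ... | yes Px | _ = Px

-- Counting lists

module _ {a p} {A : Set a} {P : Pred A p} (P? : Decidable P) where

  length-filter-∁ : ∀ xs → length xs ≡ length (filter P? xs) + length (filter (∁? P?) xs)
  length-filter-∁ []       = refl
  length-filter-∁ (x ∷ xs) with does (P? x)
  ... | true  = cong suc (length-filter-∁ xs)
  ... | false = trans (cong suc (length-filter-∁ xs)) (sym (+-suc _ _))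

module _ {a c p} {A : Set a} {C : Set c} {P : C → Pred A p} (P? : ∀ c → Decidable (P c)) where

  length-≤-cover : ∀ {k} (cs : List C) xs → All (λ c → length (filter (P? c) xs) ≤ k) cs →
                   All (λ x → Any (λ c → P c x) cs) xs → length xs ≤ length cs * k
  length-≤-cover []       []       _          _           = z≤n
  length-≤-cover []       (x ∷ xs) _          (() ∷ _)
  length-≤-cover {k} (c ∷ cs) xs (bound ∷ bounds) covered = begin
    length xs                              ≡⟨ length-filter-∁ (P? c) xs ⟩
    length (filter (P? c) xs) + length ys  ≤⟨ +-mono-≤ bound (length-≤-cover cs ys bounds′ covered′) ⟩
    k + length cs * k                      ∎
    where
    open ≤-Reasoning
    ys = filter (∁? (P? c)) xs
    bounds′ : All (λ c′ → length (filter (P? c′) ys) ≤ k) cs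
    bounds′ = All.map (≤-trans (length-mono-≤ (filter⁺ (P? _) (P? _) (λ { refl → λ x → x }) (filter-⊆ (∁? (P? c)) xs)))) bounds
    covered′ : All (λ x → Any (λ c → P c x) cs) ys
    covered′ = All.zipWith (λ (¬Pcx , any) → Any.tail ¬Pcx any) (all-filter (∁? (P? c)) xs , All.filter⁺ (∁? (P? c)) covered)

AllPairs-mapWithAll : ∀ {a p r s} {A : Set a} {P : Pred A p} {R : A → A → Set r} {S : A → A → Set s} →
                      (∀ {x y} → P x → P y → R x y → S x y) → ∀ {xs} → All P xs → AllPairs R xs → AllPairs S xs
AllPairs-mapWithAll f []         []          = []
AllPairs-mapWithAll f (px ∷ pxs) (Rx ∷ Rxs) =
  All.zipWith (λ (py , Rxy) → f px py Rxy) (pxs , Rx) ∷ AllPairs-mapWithAll f pxs Rxs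

byHead : ∀ {m} → List (Subset (suc m)) → List (Subset m) × List (Subset m)
byHead []                = [] , []
byHead ((true  ∷ x) ∷ X) = Product.map₁ (x ∷_) (byHead X)
byHead ((false ∷ x) ∷ X) = Product.map₂ (x ∷_) (byHead X)

module _ {m : ℕ} where

  length-byHead : (X : List (Subset (suc m))) → length X ≡ length (proj₁ (byHead X)) + length (proj₂ (byHead X))
  length-byHead []                = refl
  length-byHead ((true  ∷ x) ∷ X) = cong suc (length-byHead X)
  length-byHead ((false ∷ x) ∷ X) = trans (cong suc (length-byHead X)) (sym (+-suc _ _))

  byHead-All : ∀ {p q r} {P : Pred (Subset (suc m)) p} {Q₁ : Pred (Subset m) q} {Q₀ : Pred (Subset m) r} →
               (∀ {x} → P (true ∷ x) → Q₁ x) → (∀ {x} → P (false ∷ x) → Q₀ x) →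
               ∀ {X} → All P X → All Q₁ (proj₁ (byHead X)) × All Q₀ (proj₂ (byHead X))
  byHead-All to₁ to₀ []                           = [] , []
  byHead-All to₁ to₀ {(true  ∷ x) ∷ X} (px ∷ pxs) = Product.map₁ (to₁ px ∷_) (byHead-All to₁ to₀ pxs)
  byHead-All to₁ to₀ {(false ∷ x) ∷ X} (px ∷ pxs) = Product.map₂ (to₀ px ∷_) (byHead-All to₁ to₀ pxs)

  byHead-Unique : ∀ {X : List (Subset (suc m))} → Unique X → Unique (proj₁ (byHead X)) × Unique (proj₂ (byHead X))
  byHead-Unique []                           = [] , []
  byHead-Unique {(true  ∷ x) ∷ X} (x∉X ∷ X!) =
    Product.map₁ (proj₁ (byHead-All {Q₀ = λ _ → Unit.⊤} (λ x≢ → x≢ ∘ cong (true ∷_)) _ x∉X) ∷_) (byHead-Unique X!)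
  byHead-Unique {(false ∷ x) ∷ X} (x∉X ∷ X!) =
    Product.map₂ (proj₂ (byHead-All {Q₁ = λ _ → Unit.⊤} _ (λ x≢ → x≢ ∘ cong (false ∷_)) x∉X) ∷_) (byHead-Unique X!)

subsets-bound : ∀ {m} (R : Subset m) {X : List (Subset m)} → Unique X → All (_⊆ R) X → length X ≤ 2 ^ ∣ R ∣
subsets-bound []          {[]}          _               _  = z≤n
subsets-bound []          {_ ∷ []}      _               _  = s≤s z≤n
subsets-bound []          {[] ∷ [] ∷ _} ((x≢y ∷ _) ∷ _) _  = contradiction refl x≢y
subsets-bound (true  ∷ R) {X} X! X⊆ = begin
  length X                ≡⟨ length-byHead X ⟩
  length X₁ + length X₀   ≤⟨ +-mono-≤ (subsets-bound R (proj₁ (byHead-Unique X!)) (proj₁ X₁⊆R×X₀⊆R))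
                                      (subsets-bound R (proj₂ (byHead-Unique X!)) (proj₂ X₁⊆R×X₀⊆R)) ⟩
  2 ^ ∣ R ∣ + 2 ^ ∣ R ∣   ≡⟨ cong (λ k → 2 ^ ∣ R ∣ + k) (sym (+-identityʳ _)) ⟩
  2 ^ ∣ true ∷ R ∣        ∎
  where
  open ≤-Reasoning
  X₁ = proj₁ (byHead X)
  X₀ = proj₂ (byHead X)
  X₁⊆R×X₀⊆R = byHead-All (drop-∷-⊆ {s = true}) (drop-∷-⊆ {s = false}) X⊆
subsets-bound (false ∷ R) {X} X! X⊆ = begin
  length X                ≡⟨ length-byHead X ⟩
  length X₁ + length X₀   ≡⟨ cong (_+ length X₀) (length-All⊥ (proj₁ X₁-empty×X₀⊆R)) ⟩
  length X₀               ≤⟨ subsets-bound R (proj₂ (byHead-Unique X!)) (proj₂ X₁-empty×X₀⊆R) ⟩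
  2 ^ ∣ R ∣               ∎
  where
  open ≤-Reasoning
  X₁ = proj₁ (byHead X)
  X₀ = proj₂ (byHead X)
  X₁-empty×X₀⊆R = byHead-All {Q₁ = λ _ → ⊥} (λ x⊆ → case x⊆ here of λ ()) (drop-∷-⊆ {s = false}) X⊆
  length-All⊥ : ∀ {Y : List (Subset _)} → All (λ _ → ⊥) Y → length Y ≡ 0
  length-All⊥ [] = refl

-- Subsets symmetric under an involution

module Involution {n : ℕ} (ι : Fin n → Fin n) (ι-involutive : ∀ x → ι (ι x) ≡ x) where

  -- Ordering by toℕ picks one representative of each pair {x, ι x}.
  Lower : Subset n
  Lower = subset (λ x → toℕ x ≤? toℕ (ι x))

  Fixed : Subset n
  Fixed = subset (λ x → ι x ≟ x)

  ∈-Lower⁺ : ∀ {x} → toℕ x ≤ toℕ (ι x) → x ∈ Lower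
  ∈-Lower⁺ = ∈-subset⁺ (λ x → toℕ x ≤? toℕ (ι x))

  ∈-Lower⁻ : ∀ {x} → x ∈ Lower → toℕ x ≤ toℕ (ι x)
  ∈-Lower⁻ = ∈-subset⁻ (λ x → toℕ x ≤? toℕ (ι x))

  IsSymmetric : Subset n → Set
  IsSymmetric S = ∀ x → (x ∈ S) ⇔ (ι x ∈ S)

  module _ {S S′ : Subset n} (symS : IsSymmetric S) (symS′ : IsSymmetric S′) (eq : S ∩ Lower ≡ S′ ∩ Lower) where

    ∈-∩Lower : ∀ {x} → x ∈ S → x ∈ Lower → x ∈ S′
    ∈-∩Lower x∈S x∈L = proj₁ (x∈p∩q⁻ S′ Lower (subst (_ ∈_) eq (x∈p∩q⁺ (x∈S , x∈L))))

    ∩-Lower-⊆ : S ⊆ S′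
    ∩-Lower-⊆ {x} x∈S with toℕ x ≤? toℕ (ι x)
    ... | yes x≤ιx = ∈-∩Lower x∈S (∈-Lower⁺ x≤ιx)
    ... | no  x≰ιx = Equivalence.from (symS′ x) (∈-∩Lower (Equivalence.to (symS x) x∈S) (∈-Lower⁺ ιx≤ιιx))
      where
      ιx≤ιιx : toℕ (ι x) ≤ toℕ (ι (ι x))
      ιx≤ιιx = subst (λ y → toℕ (ι x) ≤ toℕ y) (sym (ι-involutive x)) (<⇒≤ (≰⇒> x≰ιx))

  ∩-Lower-injective : ∀ {S S′} → IsSymmetric S → IsSymmetric S′ → S ∩ Lower ≡ S′ ∩ Lower → S ≡ S′
  ∩-Lower-injective symS symS′ eq = ⊆-antisym (∩-Lower-⊆ symS symS′ eq) (∩-Lower-⊆ symS′ symS (sym eq))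

  symmetric-subsets-bound : ∀ {T} {X : List (Subset n)} → Unique X → All (λ S → S ⊆ T × IsSymmetric S) X →
                            length X ≤ 2 ^ ∣ T ∩ Lower ∣
  symmetric-subsets-bound {T} {X} X! X⊆ = begin
    length X                   ≡⟨ sym (length-map (_∩ Lower) X) ⟩
    length (map (_∩ Lower) X)  ≤⟨ subsets-bound (T ∩ Lower) images-unique (All.map⁺ (All.map ∩-Lower-mono X⊆)) ⟩
    2 ^ ∣ T ∩ Lower ∣          ∎
    where
    open ≤-Reasoning
    images-unique : Unique (map (_∩ Lower) X)
    images-unique = AllPairs.map⁺ (AllPairs-mapWithAll (λ (_ , symS) (_ , symS′) S≢S′ → S≢S′ ∘ ∩-Lower-injective symS symS′) X⊆ X!)
    ∩-Lower-mono : ∀ {S} → S ⊆ T × IsSymmetric S → S ∩ Lower ⊆ T ∩ Lower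
    ∩-Lower-mono (S⊆T , _) x∈S∩L = let (x∈S , x∈L) = x∈p∩q⁻ _ Lower x∈S∩L in x∈p∩q⁺ (S⊆T x∈S , x∈L)

  module _ {T : Subset n} (T-closed : ∀ {x} → x ∈ T → ι x ∈ T) where

    χ-Lower-pair : ∀ x → χ (T ∩ Lower) x + χ (T ∩ Lower) (ι x) ≤ χ T x + χ (T ∩ Fixed) x
    χ-Lower-pair x with x ∈? T
    ... | no x∉T = subst (_≤ χ T x + χ (T ∩ Fixed) x) (sym (cong₂ _+_ (χ-∉ (x∉T ∘ ∈T)) (χ-∉ (x∉T ∘ ιx∈⇒x∈T)))) z≤n
      where
      ∈T : ∀ {y} → y ∈ T ∩ Lower → y ∈ T
      ∈T = proj₁ ∘ x∈p∩q⁻ T Lower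
      ιx∈⇒x∈T : ι x ∈ T ∩ Lower → x ∈ T
      ιx∈⇒x∈T ιx∈ = subst (_∈ T) (ι-involutive x) (T-closed (∈T ιx∈))
    ... | yes x∈T with ι x ≟ x
    ...   | yes ιx≡x = begin
      χ (T ∩ Lower) x + χ (T ∩ Lower) (ι x)  ≤⟨ +-mono-≤ (χ≤1 (T ∩ Lower) x) (χ≤1 (T ∩ Lower) (ι x)) ⟩
      1 + 1                                  ≡⟨ sym (cong₂ _+_ (χ-∈ x∈T) (χ-∈ (x∈p∩q⁺ (x∈T , ∈-subset⁺ (λ x → ι x ≟ x) ιx≡x)))) ⟩
      χ T x + χ (T ∩ Fixed) x                ∎
      where open ≤-Reasoning
    ...   | no  ιx≢x = begin
      χ (T ∩ Lower) x + χ (T ∩ Lower) (ι x)  ≤⟨ χ+χ≤1 not-both-Lower ⟩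
      1                                      ≡⟨ sym (χ-∈ x∈T) ⟩
      χ T x                                  ≤⟨ m≤m+n (χ T x) _ ⟩
      χ T x + χ (T ∩ Fixed) x                ∎
      where
      open ≤-Reasoning
      not-both-Lower : x ∈ T ∩ Lower → ι x ∉ T ∩ Lower
      not-both-Lower x∈ ιx∈ = ιx≢x (sym (toℕ-injective (≤-antisym x≤ιx ιx≤x)))
        where
        x≤ιx = ∈-Lower⁻ (proj₂ (x∈p∩q⁻ T Lower x∈))
        ιx≤x = subst (λ y → toℕ (ι x) ≤ toℕ y) (ι-involutive x) (∈-Lower⁻ (proj₂ (x∈p∩q⁻ T Lower ιx∈)))

    2∣T∩Lower∣≤∣T∣+∣T∩Fixed∣ : 2 * ∣ T ∩ Lower ∣ ≤ ∣ T ∣ + ∣ T ∩ Fixed ∣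
    2∣T∩Lower∣≤∣T∣+∣T∩Fixed∣ = begin
      2 * ∣ T ∩ Lower ∣                             ≡⟨ cong (λ k → ∣ T ∩ Lower ∣ + k) (+-identityʳ _) ⟩
      ∣ T ∩ Lower ∣ + ∣ T ∩ Lower ∣
        ≡⟨ cong₂ _+_ (∣p∣≡∑χ (T ∩ Lower)) (trans (∣p∣≡∑χ (T ∩ Lower)) (∑-permute (χ (T ∩ Lower)) ι-permutation)) ⟩
      ∑ (χ (T ∩ Lower)) + ∑ (χ (T ∩ Lower) ∘ ι)     ≡⟨ sym (∑-distrib-+ (χ (T ∩ Lower)) (χ (T ∩ Lower) ∘ ι)) ⟩
      ∑ (λ x → χ (T ∩ Lower) x + χ (T ∩ Lower) (ι x)) ≤⟨ ∑-mono-≤ χ-Lower-pair ⟩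
      ∑ (λ x → χ T x + χ (T ∩ Fixed) x)             ≡⟨ ∑-distrib-+ (χ T) (χ (T ∩ Fixed)) ⟩
      ∑ (χ T) + ∑ (χ (T ∩ Fixed))                   ≡⟨ sym (cong₂ _+_ (∣p∣≡∑χ T) (∣p∣≡∑χ (T ∩ Fixed))) ⟩
      ∣ T ∣ + ∣ T ∩ Fixed ∣                         ∎
      where
      open ≤-Reasoning
      ι-permutation : Permutation′ n
      ι-permutation = permutation ι ι ι-involutive ι-involutive

-- Independent families of subsets

module InnerProduct {n : ℕ} where
  -- Opened only locally: at top level ℤ's prefix +_ would make ℕ sections such as (c +_) ambiguous.
  open import Data.Integer using (+_)

  ∑ᶻ-+ : ∀ {m} (f : Fin m → ℕ) → ∑ᶻ (λ i → + f i) ≡ + ∑ f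
  ∑ᶻ-+ {zero}  f = refl
  ∑ᶻ-+ {suc m} f = trans (cong (+ f zero +ᶻ_) (∑ᶻ-+ (f ∘ suc))) (sym (ℤ.pos-+ (f zero) _))

  square≡∣∣² : ∀ i → i *ᶻ i ≡ + (ℤ.∣ i ∣ * ℤ.∣ i ∣)
  square≡∣∣² (+ m)      = sym (ℤ.pos-* m m)
  square≡∣∣² ℤ.-[1+ m ] = refl

  Vector : Set
  Vector = Fin n → ℤ

  _+ᵛ_ : Vector → Vector → Vector
  (u +ᵛ v) x = u x +ᶻ v x

  _·ᵛ_ : ℤ → Vector → Vector
  (α ·ᵛ u) x = α *ᶻ u x

  infixl 6 _+ᵛ_
  infixl 7 _·ᵛ_

  ⟨_,_⟩ : Vector → Vector → ℤ
  ⟨ u , v ⟩ = ∑ᶻ (λ x → u x *ᶻ v x)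

  ⟨⟩-comm : ∀ u v → ⟨ u , v ⟩ ≡ ⟨ v , u ⟩
  ⟨⟩-comm u v = ∑ᶻ-cong (λ x → ℤ.*-comm (u x) (v x))

  ⟨⟩-distribʳ-+ᵛ : ∀ u v w → ⟨ u +ᵛ v , w ⟩ ≡ ⟨ u , w ⟩ +ᶻ ⟨ v , w ⟩
  ⟨⟩-distribʳ-+ᵛ u v w = trans (∑ᶻ-cong (λ x → ℤ.*-distribʳ-+ (w x) (u x) (v x)))
                                (∑ᶻ-distrib-+ (λ x → u x *ᶻ w x) (λ x → v x *ᶻ w x))

  ⟨⟩-distribˡ-+ᵛ : ∀ u v w → ⟨ u , v +ᵛ w ⟩ ≡ ⟨ u , v ⟩ +ᶻ ⟨ u , w ⟩
  ⟨⟩-distribˡ-+ᵛ u v w = begin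
    ⟨ u , v +ᵛ w ⟩           ≡⟨ ⟨⟩-comm u (v +ᵛ w) ⟩
    ⟨ v +ᵛ w , u ⟩           ≡⟨ ⟨⟩-distribʳ-+ᵛ v w u ⟩
    ⟨ v , u ⟩ +ᶻ ⟨ w , u ⟩   ≡⟨ cong₂ _+ᶻ_ (⟨⟩-comm v u) (⟨⟩-comm w u) ⟩
    ⟨ u , v ⟩ +ᶻ ⟨ u , w ⟩   ∎
    where open ≡-Reasoning

  ⟨⟩-·ᵛ : ∀ α u v → ⟨ α ·ᵛ u , v ⟩ ≡ α *ᶻ ⟨ u , v ⟩
  ⟨⟩-·ᵛ α u v = trans (∑ᶻ-cong (λ x → ℤ.*-assoc α (u x) (v x))) (sym (*ᶻ-distribˡ-∑ᶻ α (λ x → u x *ᶻ v x)))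

  ⟨⟩-bilinear : ∀ α u β v γ w δ z →
    ⟨ α ·ᵛ u +ᵛ β ·ᵛ v , γ ·ᵛ w +ᵛ δ ·ᵛ z ⟩ ≡
    α *ᶻ (γ *ᶻ ⟨ u , w ⟩ +ᶻ δ *ᶻ ⟨ u , z ⟩) +ᶻ β *ᶻ (γ *ᶻ ⟨ v , w ⟩ +ᶻ δ *ᶻ ⟨ v , z ⟩)
  ⟨⟩-bilinear α u β v γ w δ z = begin
    ⟨ α ·ᵛ u +ᵛ β ·ᵛ v , γ ·ᵛ w +ᵛ δ ·ᵛ z ⟩
      ≡⟨ ⟨⟩-distribʳ-+ᵛ (α ·ᵛ u) (β ·ᵛ v) _ ⟩
    ⟨ α ·ᵛ u , γ ·ᵛ w +ᵛ δ ·ᵛ z ⟩ +ᶻ ⟨ β ·ᵛ v , γ ·ᵛ w +ᵛ δ ·ᵛ z ⟩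
      ≡⟨ cong₂ _+ᶻ_ (⟨⟩-·ᵛ α u _) (⟨⟩-·ᵛ β v _) ⟩
    α *ᶻ ⟨ u , γ ·ᵛ w +ᵛ δ ·ᵛ z ⟩ +ᶻ β *ᶻ ⟨ v , γ ·ᵛ w +ᵛ δ ·ᵛ z ⟩
      ≡⟨ cong₂ (λ a b → α *ᶻ a +ᶻ β *ᶻ b) (expand u) (expand v) ⟩
    α *ᶻ (γ *ᶻ ⟨ u , w ⟩ +ᶻ δ *ᶻ ⟨ u , z ⟩) +ᶻ β *ᶻ (γ *ᶻ ⟨ v , w ⟩ +ᶻ δ *ᶻ ⟨ v , z ⟩) ∎
    where
    open ≡-Reasoning
    expand : ∀ t → ⟨ t , γ ·ᵛ w +ᵛ δ ·ᵛ z ⟩ ≡ γ *ᶻ ⟨ t , w ⟩ +ᶻ δ *ᶻ ⟨ t , z ⟩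
    expand t = begin
      ⟨ t , γ ·ᵛ w +ᵛ δ ·ᵛ z ⟩             ≡⟨ ⟨⟩-distribˡ-+ᵛ t _ _ ⟩
      ⟨ t , γ ·ᵛ w ⟩ +ᶻ ⟨ t , δ ·ᵛ z ⟩     ≡⟨ cong₂ _+ᶻ_ (⟨⟩-comm t _) (⟨⟩-comm t _) ⟩
      ⟨ γ ·ᵛ w , t ⟩ +ᶻ ⟨ δ ·ᵛ z , t ⟩     ≡⟨ cong₂ _+ᶻ_ (⟨⟩-·ᵛ γ w t) (⟨⟩-·ᵛ δ z t) ⟩
      γ *ᶻ ⟨ w , t ⟩ +ᶻ δ *ᶻ ⟨ z , t ⟩     ≡⟨ cong₂ (λ a b → γ *ᶻ a +ᶻ δ *ᶻ b) (⟨⟩-comm w t) (⟨⟩-comm z t) ⟩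
      γ *ᶻ ⟨ t , w ⟩ +ᶻ δ *ᶻ ⟨ t , z ⟩     ∎

  square≤⟨⟩ : ∀ u x → u x *ᶻ u x ≤ᶻ ⟨ u , u ⟩
  square≤⟨⟩ u x = subst₂ _≤ᶻ_ (sym (square≡∣∣² (u x)))
    (trans (sym (∑ᶻ-+ (λ y → ℤ.∣ u y ∣ * ℤ.∣ u y ∣))) (∑ᶻ-cong (λ y → sym (square≡∣∣² (u y)))))
    (ℤ.+≤+ (term≤∑ (λ y → ℤ.∣ u y ∣ * ℤ.∣ u y ∣) x))

  pythagoras : ∀ u v → ⟨ u , v ⟩ ≡ + 0 → ⟨ u +ᵛ v , u +ᵛ v ⟩ ≡ ⟨ u , u ⟩ +ᶻ ⟨ v , v ⟩
  pythagoras u v u⊥v = begin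
    ⟨ u +ᵛ v , u +ᵛ v ⟩
      ≡⟨ ⟨⟩-distribʳ-+ᵛ u v (u +ᵛ v) ⟩
    ⟨ u , u +ᵛ v ⟩ +ᶻ ⟨ v , u +ᵛ v ⟩
      ≡⟨ cong₂ _+ᶻ_ (⟨⟩-distribˡ-+ᵛ u u v) (⟨⟩-distribˡ-+ᵛ v u v) ⟩
    (⟨ u , u ⟩ +ᶻ ⟨ u , v ⟩) +ᶻ (⟨ v , u ⟩ +ᶻ ⟨ v , v ⟩)
      ≡⟨ cong₂ (λ a b → (⟨ u , u ⟩ +ᶻ a) +ᶻ (b +ᶻ ⟨ v , v ⟩)) u⊥v (trans (⟨⟩-comm v u) u⊥v) ⟩
    (⟨ u , u ⟩ +ᶻ + 0) +ᶻ (+ 0 +ᶻ ⟨ v , v ⟩)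
      ≡⟨ cong₂ _+ᶻ_ (ℤ.+-identityʳ ⟨ u , u ⟩) (ℤ.+-identityˡ ⟨ v , v ⟩) ⟩
    ⟨ u , u ⟩ +ᶻ ⟨ v , v ⟩
      ∎
    where open ≡-Reasoning

module IndependentFamily {n : ℕ} where
  open import Data.Integer using (+_)
  open InnerProduct {n}

  Independent : Subset n → Subset n → Set
  Independent p q = n * ∣ p ∩ q ∣ ≡ ∣ p ∣ * ∣ q ∣

  𝟙 : Subset n → Vector
  𝟙 p x = + χ p x

  ⟨𝟙,𝟙⟩ : ∀ p q → ⟨ 𝟙 p , 𝟙 q ⟩ ≡ + ∣ p ∩ q ∣
  ⟨𝟙,𝟙⟩ p q = begin
    ∑ᶻ (λ x → + χ p x *ᶻ + χ q x)  ≡⟨ ∑ᶻ-cong (λ x → trans (sym (ℤ.pos-* (χ p x) (χ q x))) (cong +_ (sym (χ-∩ p q x)))) ⟩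
    ∑ᶻ (λ x → + χ (p ∩ q) x)       ≡⟨ ∑ᶻ-+ (χ (p ∩ q)) ⟩
    + ∑ (χ (p ∩ q))                ≡⟨ cong +_ (sym (∣p∣≡∑χ (p ∩ q))) ⟩
    + ∣ p ∩ q ∣                    ∎
    where open ≡-Reasoning

  -- Independence of p and q is exactly orthogonality of centred p and centred q.
  centred : Subset n → Vector
  centred p = + n ·ᵛ 𝟙 p +ᵛ - + ∣ p ∣ ·ᵛ 𝟙 ⊤

  ⟨centred,centred⟩ : ∀ p q → ⟨ centred p , centred q ⟩ ≡ + n *ᶻ (+ n *ᶻ + ∣ p ∩ q ∣ -ᶻ + ∣ p ∣ *ᶻ + ∣ q ∣)
  ⟨centred,centred⟩ p q = begin
    ⟨ centred p , centred q ⟩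
      ≡⟨ ⟨⟩-bilinear (+ n) (𝟙 p) (- + ∣ p ∣) (𝟙 ⊤) (+ n) (𝟙 q) (- + ∣ q ∣) (𝟙 ⊤) ⟩
    expansion ⟨ 𝟙 p , 𝟙 q ⟩ ⟨ 𝟙 p , 𝟙 ⊤ ⟩ ⟨ 𝟙 ⊤ , 𝟙 q ⟩ ⟨ 𝟙 ⊤ , 𝟙 ⊤ ⟩
      ≡⟨ cong₂ (λ (t , a) (b , m) → expansion t a b m)
           (cong₂ _,_ (⟨𝟙,𝟙⟩ p q) (trans (⟨𝟙,𝟙⟩ p ⊤) (cong (+_ ∘ ∣_∣) (∩-identityʳ p))))
           (cong₂ _,_ (trans (⟨𝟙,𝟙⟩ ⊤ q) (cong (+_ ∘ ∣_∣) (∩-identityˡ q)))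
                      (trans (⟨𝟙,𝟙⟩ ⊤ ⊤) (cong (+_ ∘ ∣_∣) (∩-idem (⊤ {n}))))) ⟩
    expansion (+ ∣ p ∩ q ∣) (+ ∣ p ∣) (+ ∣ q ∣) (+ ∣ ⊤ {n} ∣)
      ≡⟨ cong (expansion (+ ∣ p ∩ q ∣) (+ ∣ p ∣) (+ ∣ q ∣) ∘ +_) (∣⊤∣≡n n) ⟩
    expansion (+ ∣ p ∩ q ∣) (+ ∣ p ∣) (+ ∣ q ∣) (+ n)
      ≡⟨ collect (+ n) (+ ∣ p ∩ q ∣) (+ ∣ p ∣) (+ ∣ q ∣) ⟩
    + n *ᶻ (+ n *ᶻ + ∣ p ∩ q ∣ -ᶻ + ∣ p ∣ *ᶻ + ∣ q ∣) ∎
    where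
    open ≡-Reasoning
    expansion : ℤ → ℤ → ℤ → ℤ → ℤ
    expansion t a b m = + n *ᶻ (+ n *ᶻ t +ᶻ - + ∣ q ∣ *ᶻ a) +ᶻ - + ∣ p ∣ *ᶻ (+ n *ᶻ b +ᶻ - + ∣ q ∣ *ᶻ m)
    collect : ∀ N T A B → N *ᶻ (N *ᶻ T +ᶻ - B *ᶻ A) +ᶻ - A *ᶻ (N *ᶻ B +ᶻ - B *ᶻ N) ≡ N *ᶻ (N *ᶻ T -ᶻ A *ᶻ B)
    collect = solve-∀

  +n≡+∣p∣+∣∁p∣ : ∀ p → + n ≡ + ∣ p ∣ +ᶻ + ∣ ∁ p ∣
  +n≡+∣p∣+∣∁p∣ p = trans (cong +_ (sym (∣p∣+∣∁p∣≡n p))) (ℤ.pos-+ ∣ p ∣ ∣ ∁ p ∣)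

  centred-orthogonal : ∀ {p q} → Independent p q → ⟨ centred p , centred q ⟩ ≡ + 0
  centred-orthogonal {p} {q} indep = begin
    ⟨ centred p , centred q ⟩
      ≡⟨ ⟨centred,centred⟩ p q ⟩
    + n *ᶻ (+ n *ᶻ + ∣ p ∩ q ∣ -ᶻ + ∣ p ∣ *ᶻ + ∣ q ∣)
      ≡⟨ cong (λ k → + n *ᶻ (k -ᶻ + ∣ p ∣ *ᶻ + ∣ q ∣)) n*∣p∩q∣≡∣p∣*∣q∣ ⟩
    + n *ᶻ (+ ∣ p ∣ *ᶻ + ∣ q ∣ -ᶻ + ∣ p ∣ *ᶻ + ∣ q ∣)
      ≡⟨ cong (+ n *ᶻ_) (ℤ.+-inverseʳ (+ ∣ p ∣ *ᶻ + ∣ q ∣)) ⟩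
    + n *ᶻ + 0
      ≡⟨ ℤ.*-zeroʳ (+ n) ⟩
    + 0
      ∎
    where
    open ≡-Reasoning
    n*∣p∩q∣≡∣p∣*∣q∣ : + n *ᶻ + ∣ p ∩ q ∣ ≡ + ∣ p ∣ *ᶻ + ∣ q ∣
    n*∣p∩q∣≡∣p∣*∣q∣ = trans (sym (ℤ.pos-* n _)) (trans (cong +_ indep) (ℤ.pos-* ∣ p ∣ ∣ q ∣))

  ⟨centred,centred⟩-diag : ∀ p → ⟨ centred p , centred p ⟩ ≡ + (n * (∣ p ∣ * ∣ ∁ p ∣))
  ⟨centred,centred⟩-diag p = begin
    ⟨ centred p , centred p ⟩
      ≡⟨ ⟨centred,centred⟩ p p ⟩
    + n *ᶻ (+ n *ᶻ + ∣ p ∩ p ∣ -ᶻ + ∣ p ∣ *ᶻ + ∣ p ∣)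
      ≡⟨ cong (λ k → + n *ᶻ (+ n *ᶻ + ∣ k ∣ -ᶻ + ∣ p ∣ *ᶻ + ∣ p ∣)) (∩-idem p) ⟩
    + n *ᶻ (+ n *ᶻ + ∣ p ∣ -ᶻ + ∣ p ∣ *ᶻ + ∣ p ∣)
      ≡⟨ cong (λ N → + n *ᶻ (N *ᶻ + ∣ p ∣ -ᶻ + ∣ p ∣ *ᶻ + ∣ p ∣)) (+n≡+∣p∣+∣∁p∣ p) ⟩
    + n *ᶻ ((+ ∣ p ∣ +ᶻ + ∣ ∁ p ∣) *ᶻ + ∣ p ∣ -ᶻ + ∣ p ∣ *ᶻ + ∣ p ∣)
      ≡⟨ cong (+ n *ᶻ_) (cancel (+ ∣ p ∣) (+ ∣ ∁ p ∣)) ⟩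
    + n *ᶻ (+ ∣ p ∣ *ᶻ + ∣ ∁ p ∣)
      ≡⟨ cong (+ n *ᶻ_) (sym (ℤ.pos-* ∣ p ∣ ∣ ∁ p ∣)) ⟩
    + n *ᶻ + (∣ p ∣ * ∣ ∁ p ∣)
      ≡⟨ sym (ℤ.pos-* n _) ⟩
    + (n * (∣ p ∣ * ∣ ∁ p ∣))
      ∎
    where
    open ≡-Reasoning
    cancel : ∀ A C → (A +ᶻ C) *ᶻ A -ᶻ A *ᶻ A ≡ A *ᶻ C
    cancel = solve-∀

  centred-∈ : ∀ {p x} → x ∈ p → centred p x ≡ + ∣ ∁ p ∣
  centred-∈ {p} {x} x∈p = begin
    + n *ᶻ + χ p x +ᶻ - + ∣ p ∣ *ᶻ + χ (⊤ {n}) x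
      ≡⟨ cong₂ (λ a b → + n *ᶻ + a +ᶻ - + ∣ p ∣ *ᶻ + b) (χ-∈ {p = p} x∈p) (χ-∈ {p = ⊤ {n}} ∈⊤) ⟩
    + n *ᶻ + 1 +ᶻ - + ∣ p ∣ *ᶻ + 1
      ≡⟨ cong (λ N → N *ᶻ + 1 +ᶻ - + ∣ p ∣ *ᶻ + 1) (+n≡+∣p∣+∣∁p∣ p) ⟩
    (+ ∣ p ∣ +ᶻ + ∣ ∁ p ∣) *ᶻ + 1 +ᶻ - + ∣ p ∣ *ᶻ + 1
      ≡⟨ cancel (+ ∣ p ∣) (+ ∣ ∁ p ∣) ⟩
    + ∣ ∁ p ∣
      ∎
    where
    open ≡-Reasoning
    cancel : ∀ A C → (A +ᶻ C) *ᶻ + 1 +ᶻ - A *ᶻ + 1 ≡ C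
    cancel = solve-∀

  centredSum : List (Subset n) → Vector
  centredSum []       _ = + 0
  centredSum (p ∷ ps)   = centred p +ᵛ centredSum ps

  centredSum-orthogonal : ∀ {p} ps → All (Independent p) ps → ⟨ centred p , centredSum ps ⟩ ≡ + 0
  centredSum-orthogonal {p} []       []               = trans (∑ᶻ-cong (λ x → ℤ.*-zeroʳ (centred p x))) (∑ᶻ-zero n)
  centredSum-orthogonal {p} (q ∷ qs) (indep ∷ indeps) = begin
    ⟨ centred p , centred q +ᵛ centredSum qs ⟩
      ≡⟨ ⟨⟩-distribˡ-+ᵛ (centred p) (centred q) (centredSum qs) ⟩
    ⟨ centred p , centred q ⟩ +ᶻ ⟨ centred p , centredSum qs ⟩
      ≡⟨ cong₂ _+ᶻ_ (centred-orthogonal {p} {q} indep) (centredSum-orthogonal {p} qs indeps) ⟩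
    + 0
      ∎
    where open ≡-Reasoning

  ∑∣∁p∣ : List (Subset n) → ℕ
  ∑∣∁p∣ ps = sum (map (λ p → ∣ ∁ p ∣) ps)

  ∑n∣p∣∣∁p∣ : List (Subset n) → ℕ
  ∑n∣p∣∣∁p∣ ps = sum (map (λ p → n * (∣ p ∣ * ∣ ∁ p ∣)) ps)

  ⟨centredSum,centredSum⟩ : ∀ {ps} → AllPairs Independent ps → ⟨ centredSum ps , centredSum ps ⟩ ≡ + ∑n∣p∣∣∁p∣ ps
  ⟨centredSum,centredSum⟩ []                        = ∑ᶻ-zero n
  ⟨centredSum,centredSum⟩ {p ∷ ps} (indeps ∷ pairs) = begin
    ⟨ centred p +ᵛ centredSum ps , centred p +ᵛ centredSum ps ⟩
      ≡⟨ pythagoras (centred p) (centredSum ps) (centredSum-orthogonal {p} ps indeps) ⟩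
    ⟨ centred p , centred p ⟩ +ᶻ ⟨ centredSum ps , centredSum ps ⟩
      ≡⟨ cong₂ _+ᶻ_ (⟨centred,centred⟩-diag p) (⟨centredSum,centredSum⟩ {ps} pairs) ⟩
    + (n * (∣ p ∣ * ∣ ∁ p ∣)) +ᶻ + ∑n∣p∣∣∁p∣ ps
      ≡⟨ sym (ℤ.pos-+ (n * (∣ p ∣ * ∣ ∁ p ∣)) _) ⟩
    + ∑n∣p∣∣∁p∣ (p ∷ ps) ∎
    where open ≡-Reasoning

  centredSum-∈ : ∀ {x ps} → All (x ∈_) ps → centredSum ps x ≡ + ∑∣∁p∣ ps
  centredSum-∈ []                   = refl
  centredSum-∈ {ps = p ∷ ps} (x∈p ∷ x∈ps) =
    trans (cong₂ _+ᶻ_ (centred-∈ {p} x∈p) (centredSum-∈ x∈ps)) (sym (ℤ.pos-+ ∣ ∁ p ∣ _))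

  [∑∣∁p∣]²≤∑n∣p∣∣∁p∣ : ∀ {x} ps → All (x ∈_) ps → AllPairs Independent ps → ∑∣∁p∣ ps * ∑∣∁p∣ ps ≤ ∑n∣p∣∣∁p∣ ps
  [∑∣∁p∣]²≤∑n∣p∣∣∁p∣ {x} ps x∈ps pairs = ℤ.drop‿+≤+ (subst₂ _≤ᶻ_
    (trans (cong₂ _*ᶻ_ (centredSum-∈ x∈ps) (centredSum-∈ x∈ps)) (sym (ℤ.pos-* (∑∣∁p∣ ps) (∑∣∁p∣ ps))))
    (⟨centredSum,centredSum⟩ pairs)
    (square≤⟨⟩ (centredSum ps) x))

  2∑n∣p∣∣∁p∣≤n²∑∣∁p∣ : ∀ {ps} → All (λ p → ∣ p ∣ ≤ ∣ ∁ p ∣) ps → 2 * ∑n∣p∣∣∁p∣ ps ≤ n * (n * ∑∣∁p∣ ps)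
  2∑n∣p∣∣∁p∣≤n²∑∣∁p∣ []                    = z≤n
  2∑n∣p∣∣∁p∣≤n²∑∣∁p∣ {p ∷ ps} (small ∷ smalls) = begin
    2 * (n * (a * c) + ∑n∣p∣∣∁p∣ ps)            ≡⟨ *-distribˡ-+ 2 (n * (a * c)) _ ⟩
    2 * (n * (a * c)) + 2 * ∑n∣p∣∣∁p∣ ps        ≡⟨ cong (_+ 2 * ∑n∣p∣∣∁p∣ ps) (reassociate 2 n a c) ⟩
    n * (2 * a * c) + 2 * ∑n∣p∣∣∁p∣ ps          ≤⟨ +-mono-≤ (*-monoʳ-≤ n (*-monoˡ-≤ c (∣p∣≤∣∁p∣⇒2∣p∣≤n p small)))
                                                              (2∑n∣p∣∣∁p∣≤n²∑∣∁p∣ smalls) ⟩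
    n * (n * c) + n * (n * ∑∣∁p∣ ps)            ≡⟨ sym (trans (cong (n *_) (*-distribˡ-+ n c _)) (*-distribˡ-+ n (n * c) _)) ⟩
    n * (n * (c + ∑∣∁p∣ ps))                    ∎
    where
    open ≤-Reasoning
    a = ∣ p ∣
    c = ∣ ∁ p ∣
    reassociate : ∀ k m x y → k * (m * (x * y)) ≡ m * (k * x * y)
    reassociate = solve-∀ℕ

  length*n≤2∑∣∁p∣ : ∀ {ps} → All (λ p → ∣ p ∣ ≤ ∣ ∁ p ∣) ps → length ps * n ≤ 2 * ∑∣∁p∣ ps
  length*n≤2∑∣∁p∣ []                          = z≤n
  length*n≤2∑∣∁p∣ {p ∷ ps} (small ∷ smalls) = begin
    n + length ps * n             ≤⟨ +-mono-≤ (∣p∣≤∣∁p∣⇒n≤2∣∁p∣ p small) (length*n≤2∑∣∁p∣ smalls) ⟩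
    2 * ∣ ∁ p ∣ + 2 * ∑∣∁p∣ ps    ≡⟨ sym (*-distribˡ-+ 2 ∣ ∁ p ∣ (∑∣∁p∣ ps)) ⟩
    2 * (∣ ∁ p ∣ + ∑∣∁p∣ ps)      ∎
    where open ≤-Reasoning

  independent-family-bound : ∀ {x} ps → All (x ∈_) ps → All (λ p → ∣ p ∣ ≤ ∣ ∁ p ∣) ps →
                             AllPairs Independent ps → length ps ≤ n
  independent-family-bound {x} ps x∈ps smalls pairs = q²≤d∧2d≤n²q∧mn≤2q⇒m≤n {{nonZeroIndex x}}
    ([∑∣∁p∣]²≤∑n∣p∣∣∁p∣ ps x∈ps pairs) (2∑n∣p∣∣∁p∣≤n²∑∣∁p∣ smalls) (length*n≤2∑∣∁p∣ smalls)

-- Subgroups of a finite abelian group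

module FiniteAbelianGroup {n : ℕ} (G : FinAbGroup n) where
  open FinAbGroup G
  open IsAbelianGroup isAbelianGroup using (assoc; comm; identityˡ; inverseˡ; inverseʳ)

  abelianGroup : AbelianGroup 0ℓ 0ℓ
  abelianGroup = record { isAbelianGroup = isAbelianGroup }

  open IndependentFamily {n} using (Independent)
  open import Algebra.Solver.CommutativeMonoid (AbelianGroup.commutativeMonoid abelianGroup) using (solve; _⊕_; _⊜_)
  open GroupProperties (AbelianGroup.group abelianGroup)
    using (⁻¹-involutive; ⁻¹-anti-homo-∙; ε⁻¹≈ε; \\-leftDividesˡ; \\-leftDividesʳ; //-rightDividesʳ)

  translation : Fin n → Permutation′ n
  translation g = permutation (g ·_) ((g ⁻¹) ·_) (\\-leftDividesˡ g) (\\-leftDividesʳ g)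

  ∣∣-mono-translation : ∀ g {p q} → (∀ {x} → x ∈ p → g · x ∈ q) → ∣ p ∣ ≤ ∣ q ∣
  ∣∣-mono-translation g = ∣∣-mono-permutation (translation g)

  Proper : Subset n → Set
  Proper H = ∃ λ a → a ∉ H

  module Subgroup {H : Subset n} (H-subgroup : IsSubgroup G H) where

    ε∈H : ε ∈ H
    ε∈H = proj₁ H-subgroup

    ·-closed : ∀ {a b} → a ∈ H → b ∈ H → a · b ∈ H
    ·-closed = proj₁ (proj₂ H-subgroup) _ _

    ⁻¹-closed : ∀ {a} → a ∈ H → a ⁻¹ ∈ H
    ⁻¹-closed = proj₂ (proj₂ H-subgroup) _

    ⁻¹-closed⁻ : ∀ {a} → a ⁻¹ ∈ H → a ∈ H
    ⁻¹-closed⁻ {a} a⁻¹∈H = subst (_∈ H) (⁻¹-involutive a) (⁻¹-closed a⁻¹∈H)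

    ∈-cancelˡ : ∀ {a x} → a ∈ H → a · x ∈ H → x ∈ H
    ∈-cancelˡ {a} {x} a∈H ax∈H = subst (_∈ H) (\\-leftDividesʳ a x) (·-closed (⁻¹-closed a∈H) ax∈H)

    ∈-cancelʳ : ∀ {a x} → x ∈ H → a · x ∈ H → a ∈ H
    ∈-cancelʳ {a} {x} x∈H ax∈H = subst (_∈ H) (//-rightDividesʳ x a) (·-closed ax∈H (⁻¹-closed x∈H))

    ∣H∣≤∣∁H∣ : Proper H → ∣ H ∣ ≤ ∣ ∁ H ∣
    ∣H∣≤∣∁H∣ (a , a∉H) = ∣∣-mono-translation a (λ x∈H → x∉p⇒x∈∁p (a∉H ∘ ∈-cancelʳ x∈H))

  module IndexTwo {B : Subset n} (B-index-two : IsIndexTwoSubgroup G B) where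
    open Subgroup (proj₁ B-index-two)

    ∣∁B∣≡∣B∣ : ∣ ∁ B ∣ ≡ ∣ B ∣
    ∣∁B∣≡∣B∣ = +-cancelˡ-≡ ∣ B ∣ _ _ (begin
      ∣ B ∣ + ∣ ∁ B ∣    ≡⟨ ∣p∣+∣∁p∣≡n B ⟩
      n                  ≡⟨ sym (proj₂ B-index-two) ⟩
      2 * ∣ B ∣          ≡⟨ cong (λ k → ∣ B ∣ + k) (+-identityʳ ∣ B ∣) ⟩
      ∣ B ∣ + ∣ B ∣      ∎)
      where open ≡-Reasoning

    -- Otherwise translation by s maps B ∪ ⁅ x ⁆ into ∁ B, which is no larger than B.
    ∉·∉⇒∈ : ∀ {s x} → s ∉ B → x ∉ B → s · x ∈ B
    ∉·∉⇒∈ {s} {x} s∉B x∉B with s · x ∈? B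
    ... | yes sx∈B = sx∈B
    ... | no  sx∉B = contradiction (p⊂q⇒∣p∣<∣q∣ B⊂B∪⁅x⁆)
                                   (≤⇒≯ (≤-trans (∣∣-mono-translation s into-∁B) (≤-reflexive ∣∁B∣≡∣B∣)))
      where
      B⊂B∪⁅x⁆ : B ⊂ B ∪ ⁅ x ⁆
      B⊂B∪⁅x⁆ = p⊆p∪q ⁅ x ⁆ , x , x∈p∪q⁺ (inj₂ (x∈⁅x⁆ x)) , x∉B
      into-∁B : ∀ {y} → y ∈ B ∪ ⁅ x ⁆ → s · y ∈ ∁ B
      into-∁B {y} y∈ with x∈p∪q⁻ B ⁅ x ⁆ y∈
      ... | inj₁ y∈B   = x∉p⇒x∈∁p (s∉B ∘ ∈-cancelʳ y∈B)
      ... | inj₂ y∈⁅x⁆ = x∉p⇒x∈∁p (subst (λ z → s · z ∉ B) (sym (x∈⁅y⁆⇒x≡y x y∈⁅x⁆)) sx∉B)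

    4∣M∩∁B∣≤n : ∀ {M} → IsSubgroup G M → Proper M → 4 * ∣ M ∩ ∁ B ∣ ≤ n
    4∣M∩∁B∣≤n {M} M-subgroup M-proper with nonempty? (M ∩ ∁ B)
    ... | no  empty = subst (λ k → 4 * k ≤ n) (sym (trans (cong ∣_∣ (Empty-unique empty)) (∣⊥∣≡0 n))) z≤n
    ... | yes (s , s∈M∩∁B) = begin
      4 * t              ≡⟨ *-assoc 2 2 t ⟩
      2 * (2 * t)        ≤⟨ *-monoʳ-≤ 2 2t≤∣M∣ ⟩
      2 * ∣ M ∣          ≤⟨ ∣p∣≤∣∁p∣⇒2∣p∣≤n M (Subgroup.∣H∣≤∣∁H∣ M-subgroup M-proper) ⟩
      n                  ∎
      where
      open ≤-Reasoning
      t = ∣ M ∩ ∁ B ∣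
      open Subgroup M-subgroup using () renaming (·-closed to ·-closedᴹ)
      t≤∣M∩B∣ : t ≤ ∣ M ∩ B ∣
      t≤∣M∩B∣ = ∣∣-mono-translation s λ x∈M∩∁B →
        let (s∈M , s∈∁B) = x∈p∩q⁻ M (∁ B) s∈M∩∁B
            (x∈M , x∈∁B) = x∈p∩q⁻ M (∁ B) x∈M∩∁B
        in x∈p∩q⁺ (·-closedᴹ s∈M x∈M , ∉·∉⇒∈ (x∈∁p⇒x∉p s∈∁B) (x∈∁p⇒x∉p x∈∁B))
      2t≤∣M∣ : 2 * t ≤ ∣ M ∣
      2t≤∣M∣ = begin
        2 * t              ≡⟨ cong (λ k → t + k) (+-identityʳ t) ⟩
        t + t              ≤⟨ +-monoʳ-≤ t t≤∣M∩B∣ ⟩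
        t + ∣ M ∩ B ∣      ≡⟨ ∣p∩∁q∣+∣p∩q∣≡∣p∣ M B ⟩
        ∣ M ∣              ∎

  isSubgroup? : Decidable (IsSubgroup G)
  isSubgroup? H = ε ∈? H
            ×-dec all? (λ a → all? (λ b → a ∈? H →-dec b ∈? H →-dec a · b ∈? H))
            ×-dec all? (λ a → a ∈? H →-dec a ⁻¹ ∈? H)

  proper? : Decidable Proper
  proper? H = any? (λ a → ¬? (a ∈? H))

  Maximal : Subset n → Set
  Maximal M = IsSubgroup G M × Proper M × (∀ {K} → IsSubgroup G K → Proper K → M ⊆ K → K ⊆ M)

  maximal-above : ∀ {H} → Acc _⊃_ H → IsSubgroup G H → Proper H → ∃ λ M → Maximal M × H ⊆ M
  maximal-above {H} (acc rec) H-subgroup H-proper with anySubset? (λ K → isSubgroup? K ×-dec proper? K ×-dec H ⊂? K)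
  ... | yes (K , K-subgroup , K-proper , H⊂K) =
    let (M , M-maximal , K⊆M) = maximal-above (rec H⊂K) K-subgroup K-proper in M , M-maximal , K⊆M ∘ proj₁ H⊂K
  ... | no  ∄K = H , (H-subgroup , H-proper , maximality) , id
    where
    maximality : ∀ {K} → IsSubgroup G K → Proper K → H ⊆ K → K ⊆ H
    maximality {K} K-subgroup K-proper H⊆K {x} x∈K with x ∈? H
    ... | yes x∈H = x∈H
    ... | no  x∉H = contradiction (K , K-subgroup , K-proper , (λ {y} → H⊆K {y}) , x , x∈K , x∉H) ∄K

  proper-subgroup-above : ∀ {S} → GenProper G S → ∃ λ H → IsSubgroup G H × Proper H × S ⊆ H
  proper-subgroup-above {S} ⟨S⟩≢A with anySubset? (λ H → isSubgroup? H ×-dec proper? H ×-dec S ⊆? H)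
  ... | yes found = found
  ... | no  ∄H    = contradiction ⟨S⟩≡A ⟨S⟩≢A
    where
    ⟨S⟩≡A : ∀ a → _∈⟨_⟩ G a S
    ⟨S⟩≡A a H H-subgroup S⊆H with a ∈? H
    ... | yes a∈H = a∈H
    ... | no  a∉H = contradiction (H , H-subgroup , (a , a∉H) , (λ {x} → S⊆H {x})) ∄H

  maximal-above-generated : ∀ {S} → GenProper G S → ∃ λ M → Maximal M × S ⊆ M
  maximal-above-generated ⟨S⟩≢A =
    let (H , H-subgroup , H-proper , S⊆H) = proper-subgroup-above ⟨S⟩≢A
        (M , M-maximal , H⊆M) = maximal-above (⊃-wellFounded H) H-subgroup H-proper
    in M , M-maximal , H⊆M ∘ S⊆H

  module _ {H K : Subset n} (H-subgroup : IsSubgroup G H) (K-subgroup : IsSubgroup G K)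
           (HK≡A : ∀ c → ∃ λ h → h ∈ H × (h ⁻¹) · c ∈ K) where
    open Subgroup H-subgroup using () renaming (·-closed to ·-closedᴴ; ∈-cancelˡ to ∈-cancelˡᴴ)
    open Subgroup K-subgroup using () renaming (·-closed to ·-closedᴷ; ⁻¹-closed to ⁻¹-closedᴷ;
                                                  ⁻¹-closed⁻ to ⁻¹-closed⁻ᴷ; ∈-cancelʳ to ∈-cancelʳᴷ)

    fibre-size : ∀ c → ∑ (λ a → χ H a * χ K ((a ⁻¹) · c)) ≡ ∣ H ∩ K ∣
    fibre-size c = begin
      ∑ (λ a → χ H a * χ K ((a ⁻¹) · c))
        ≡⟨ ∑-permute _ (translation h) ⟩
      ∑ (λ x → χ H (h · x) * χ K (((h · x) ⁻¹) · c))
        ≡⟨ sum-cong-≗ (λ x → cong₂ _*_ (χ-cong (∈-cancelˡᴴ h∈H) (·-closedᴴ h∈H)) (χ-cong (coset⇒∈ x) (∈⇒coset x))) ⟩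
      ∑ (λ x → χ H x * χ K x)
        ≡⟨ sum-cong-≗ (λ x → sym (χ-∩ H K x)) ⟩
      ∑ (χ (H ∩ K))
        ≡⟨ sym (∣p∣≡∑χ (H ∩ K)) ⟩
      ∣ H ∩ K ∣
        ∎
      where
      open ≡-Reasoning
      h = proj₁ (HK≡A c)
      h∈H = proj₁ (proj₂ (HK≡A c))
      k∈K = proj₂ (proj₂ (HK≡A c))
      shift : ∀ x → ((h · x) ⁻¹) · c ≡ (x ⁻¹) · ((h ⁻¹) · c)
      shift x = trans (cong (_· c) (⁻¹-anti-homo-∙ h x)) (assoc (x ⁻¹) (h ⁻¹) c)
      coset⇒∈ : ∀ x → ((h · x) ⁻¹) · c ∈ K → x ∈ K
      coset⇒∈ x ∈K = ⁻¹-closed⁻ᴷ (∈-cancelʳᴷ k∈K (subst (_∈ K) (shift x) ∈K))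
      ∈⇒coset : ∀ x → x ∈ K → ((h · x) ⁻¹) · c ∈ K
      ∈⇒coset x x∈K = subst (_∈ K) (sym (shift x)) (·-closedᴷ (⁻¹-closedᴷ x∈K) k∈K)

    -- Count the pairs (a , c) with a ∈ H and a⁻¹ c ∈ K in two ways.
    product-formula : n * ∣ H ∩ K ∣ ≡ ∣ H ∣ * ∣ K ∣
    product-formula = sym (begin
      ∣ H ∣ * ∣ K ∣
        ≡⟨ cong₂ _*_ (∣p∣≡∑χ H) (∣p∣≡∑χ K) ⟩
      ∑ (χ H) * ∑ (χ K)
        ≡⟨ *-distribʳ-∑ (∑ (χ K)) (χ H) ⟩
      ∑ (λ a → χ H a * ∑ (χ K))
        ≡⟨ sum-cong-≗ (λ a → cong (χ H a *_) (∑-permute (χ K) (translation (a ⁻¹)))) ⟩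
      ∑ (λ a → χ H a * ∑ (λ c → χ K ((a ⁻¹) · c)))
        ≡⟨ sum-cong-≗ (λ a → *-distribˡ-∑ (χ H a) (λ c → χ K ((a ⁻¹) · c))) ⟩
      ∑ (λ a → ∑ (λ c → χ H a * χ K ((a ⁻¹) · c)))
        ≡⟨ ∑-comm (λ a c → χ H a * χ K ((a ⁻¹) · c)) ⟩
      ∑ (λ c → ∑ (λ a → χ H a * χ K ((a ⁻¹) · c)))
        ≡⟨ sum-cong-≗ fibre-size ⟩
      ∑ {n} (λ _ → ∣ H ∩ K ∣)
        ≡⟨ ∑-const n ∣ H ∩ K ∣ ⟩
      n * ∣ H ∩ K ∣
        ∎)
      where open ≡-Reasoning

  module _ {M₁ M₂ : Subset n} (M₁-maximal : Maximal M₁) (M₂-maximal : Maximal M₂) where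
    private
      M₁-subgroup = proj₁ M₁-maximal
      M₂-subgroup = proj₁ M₂-maximal
      module M₁ = Subgroup M₁-subgroup
      module M₂ = Subgroup M₂-subgroup

      Factorisable : Fin n → Set
      Factorisable c = ∃ λ a → a ∈ M₁ × (a ⁻¹) · c ∈ M₂

      product : Subset n
      product = subset (λ c → any? (λ a → a ∈? M₁ ×-dec (a ⁻¹) · c ∈? M₂))

      ∈-product⁺ : ∀ {c} → Factorisable c → c ∈ product
      ∈-product⁺ = ∈-subset⁺ (λ c → any? (λ a → a ∈? M₁ ×-dec (a ⁻¹) · c ∈? M₂))

      ∈-product⁻ : ∀ {c} → c ∈ product → Factorisable c
      ∈-product⁻ = ∈-subset⁻ (λ c → any? (λ a → a ∈? M₁ ×-dec (a ⁻¹) · c ∈? M₂))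

      product-subgroup : IsSubgroup G product
      product-subgroup = ∈-product⁺ (ε , M₁.ε∈H , subst (_∈ M₂) (sym (inverseˡ ε)) M₂.ε∈H)
                       , (λ c c′ c∈ c′∈ → ∈-product⁺ (·-factorisable (∈-product⁻ c∈) (∈-product⁻ c′∈)))
                       , (λ c c∈ → ∈-product⁺ (⁻¹-factorisable (∈-product⁻ c∈)))
        where
        ·-factorisable : ∀ {c c′} → Factorisable c → Factorisable c′ → Factorisable (c · c′)
        ·-factorisable {c} {c′} (a , a∈ , ac∈) (a′ , a′∈ , a′c′∈) =
          a · a′ , M₁.·-closed a∈ a′∈ , subst (_∈ M₂) (sym (rearrange a a′ c c′)) (M₂.·-closed ac∈ a′c′∈)
          where
          rearrange : ∀ a a′ c c′ → ((a · a′) ⁻¹) · (c · c′) ≡ ((a ⁻¹) · c) · ((a′ ⁻¹) · c′)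
          rearrange a a′ c c′ = trans (cong (_· (c · c′)) (⁻¹-anti-homo-∙ a a′))
            (solve 4 (λ x y z w → (y ⊕ x) ⊕ (z ⊕ w) ⊜ (x ⊕ z) ⊕ (y ⊕ w)) refl (a ⁻¹) (a′ ⁻¹) c c′)
        ⁻¹-factorisable : ∀ {c} → Factorisable c → Factorisable (c ⁻¹)
        ⁻¹-factorisable {c} (a , a∈ , ac∈) =
          a ⁻¹ , M₁.⁻¹-closed a∈ ,
          subst (_∈ M₂) (trans (⁻¹-anti-homo-∙ (a ⁻¹) c) (comm (c ⁻¹) ((a ⁻¹) ⁻¹))) (M₂.⁻¹-closed ac∈)

      M₁⊆product : M₁ ⊆ product
      M₁⊆product {x} x∈M₁ = ∈-product⁺ (x , x∈M₁ , subst (_∈ M₂) (sym (inverseˡ x)) M₂.ε∈H)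

      M₂⊆product : M₂ ⊆ product
      M₂⊆product {x} x∈M₂ = ∈-product⁺ (ε , M₁.ε∈H , subst (_∈ M₂) (sym (trans (cong (_· x) ε⁻¹≈ε) (identityˡ x))) x∈M₂)

      distinct-maximal-factorisable : M₁ ≢ M₂ → ∀ c → Factorisable c
      distinct-maximal-factorisable M₁≢M₂ c with c ∈? product
      ... | yes c∈ = ∈-product⁻ c∈
      ... | no  c∉ = contradiction (⊆-antisym M₁⊆M₂ M₂⊆M₁) M₁≢M₂
        where
        M₂⊆M₁ : M₂ ⊆ M₁
        M₂⊆M₁ = proj₂ (proj₂ M₁-maximal) product-subgroup (c , c∉) M₁⊆product ∘ M₂⊆product
        M₁⊆M₂ : M₁ ⊆ M₂
        M₁⊆M₂ = proj₂ (proj₂ M₂-maximal) M₁-subgroup (proj₁ (proj₂ M₁-maximal)) M₂⊆M₁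

    distinct-maximal-independent : M₁ ≢ M₂ → Independent M₁ M₂
    distinct-maximal-independent M₁≢M₂ = product-formula M₁-subgroup M₂-subgroup (distinct-maximal-factorisable M₁≢M₂)

  maximal-family-bound : ∀ {Ms} → Unique Ms → All Maximal Ms → length Ms ≤ n
  maximal-family-bound {Ms} Ms! Ms-maximal = IndependentFamily.independent-family-bound {x = ε} Ms
    (All.map (λ (M-subgroup , _) → Subgroup.ε∈H M-subgroup) Ms-maximal)
    (All.map (λ (M-subgroup , M-proper , _) → Subgroup.∣H∣≤∣∁H∣ M-subgroup M-proper) Ms-maximal)
    (AllPairs-mapWithAll distinct-maximal-independent Ms-maximal Ms!)

  module Inverse = Involution _⁻¹ ⁻¹-involutive

  module Counting {B : Subset n} (B-index-two : IsIndexTwoSubgroup G B) where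
    open IndexTwo B-index-two using (4∣M∩∁B∣≤n)

    k : ℕ
    k = ∣ A₂∖ G B ∣

    -- The floor is harmless: each exponent ∣(M ∩ ∁ B) ∩ Lower∣ is an integer ≤ (n + 4k)/8.
    e : ℕ
    e = (n + 4 * k) / 8

    Fixed∖B⊆A₂∖B : ∀ M → (M ∩ ∁ B) ∩ Inverse.Fixed ⊆ A₂∖ G B
    Fixed∖B⊆A₂∖B M {x} x∈ =
      let (x∈M∩∁B , x∈Fixed) = x∈p∩q⁻ (M ∩ ∁ B) Inverse.Fixed x∈
          x⁻¹≡x = ∈-subset⁻ (λ y → (y ⁻¹) ≟ y) x∈Fixed
      in ∈-subset⁺ (λ a → (a · a) ≟ ε ×-dec ¬? (a ∈? B))
           (trans (cong (x ·_) (sym x⁻¹≡x)) (inverseʳ x) , x∈∁p⇒x∉p (proj₂ (x∈p∩q⁻ M (∁ B) x∈M∩∁B)))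

    8∣Lower∣≤n+4k : ∀ {M} → Maximal M → 8 * ∣ (M ∩ ∁ B) ∩ Inverse.Lower ∣ ≤ n + 4 * k
    8∣Lower∣≤n+4k {M} (M-subgroup , M-proper , _) = begin
      8 * r                                     ≡⟨ *-assoc 4 2 r ⟩
      4 * (2 * r)                               ≤⟨ *-monoʳ-≤ 4 (Inverse.2∣T∩Lower∣≤∣T∣+∣T∩Fixed∣ T-closed) ⟩
      4 * (∣ T ∣ + ∣ T ∩ Inverse.Fixed ∣)      ≤⟨ *-monoʳ-≤ 4 (+-monoʳ-≤ ∣ T ∣ (p⊆q⇒∣p∣≤∣q∣ (Fixed∖B⊆A₂∖B M))) ⟩
      4 * (∣ T ∣ + k)                           ≡⟨ *-distribˡ-+ 4 ∣ T ∣ k ⟩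
      4 * ∣ T ∣ + 4 * k                         ≤⟨ +-monoˡ-≤ (4 * k) (4∣M∩∁B∣≤n M-subgroup M-proper) ⟩
      n + 4 * k                                 ∎
      where
      open ≤-Reasoning
      T = M ∩ ∁ B
      r = ∣ T ∩ Inverse.Lower ∣
      T-closed : ∀ {x} → x ∈ T → x ⁻¹ ∈ T
      T-closed x∈T =
        let (x∈M , x∈∁B) = x∈p∩q⁻ M (∁ B) x∈T
        in x∈p∩q⁺ ( Subgroup.⁻¹-closed M-subgroup x∈M
                  , x∉p⇒x∈∁p (x∈∁p⇒x∉p x∈∁B ∘ Subgroup.⁻¹-closed⁻ (proj₁ B-index-two)))

    counted-in-maximal : ∀ {M} → Maximal M → ∀ {L} → Unique L → All (Counted G B) L →
                         length (filter (_⊆? M ∩ ∁ B) L) ≤ 2 ^ e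
    counted-in-maximal {M} M-maximal {L} L! counted = begin
      length (filter (_⊆? M ∩ ∁ B) L)   ≤⟨ Inverse.symmetric-subsets-bound (Unique.filter⁺ (_⊆? M ∩ ∁ B) L!) in-T-symmetric ⟩
      2 ^ r                             ≤⟨ ^-monoʳ-≤ 2 r≤e ⟩
      2 ^ e                             ∎
      where
      open ≤-Reasoning
      T = M ∩ ∁ B
      r = ∣ T ∩ Inverse.Lower ∣
      in-T-symmetric : All (λ S → S ⊆ T × Inverse.IsSymmetric S) (filter (_⊆? T) L)
      in-T-symmetric = All.zip (all-filter (_⊆? T) L , All.filter⁺ (_⊆? T) (All.map (proj₁ ∘ proj₂) counted))
      r≤e : r ≤ e
      r≤e = begin
        r                 ≡⟨ sym (m*n/n≡m r 8) ⟩
        r * 8 / 8         ≤⟨ /-monoˡ-≤ 8 (≤-trans (≤-reflexive (*-comm r 8)) (8∣Lower∣≤n+4k M-maximal)) ⟩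
        e                 ∎

    maximal-cover : ∀ {L} → All (Counted G B) L →
                    ∃ λ Ms → Unique Ms × All Maximal Ms × All (λ S → Any (λ M → S ⊆ M ∩ ∁ B) Ms) L
    maximal-cover counted =
      let (Ms , Ms-maximal , covered) = cover counted
      in deduplicate _≟ˢ_ Ms , deduplicate-! _≟ˢ_ Ms , All.deduplicate⁺ _≟ˢ_ Ms-maximal ,
         All.map (Any.deduplicate⁺ _≟ˢ_ (λ { refl → id })) covered
      where
      _≟ˢ_ : DecidableEquality (Subset n)
      _≟ˢ_ = ≡-dec Bool._≟_
      cover : ∀ {L} → All (Counted G B) L → ∃ λ Ms → All Maximal Ms × All (λ S → Any (λ M → S ⊆ M ∩ ∁ B) Ms) L
      cover []                                 = [] , [] , []
      cover ((S⊆∁B , _ , ⟨S⟩≢A) ∷ counted) =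
        let (M , M-maximal , S⊆M) = maximal-above-generated ⟨S⟩≢A
            (Ms , Ms-maximal , covered) = cover counted
        in M ∷ Ms , M-maximal ∷ Ms-maximal ,
           Any.here (λ x∈S → x∈p∩q⁺ (S⊆M x∈S , x∉p⇒x∈∁p (S⊆∁B _ x∈S))) ∷ All.map Any.there covered

    length≤n*2^e : ∀ {L} → Unique L → All (Counted G B) L → length L ≤ n * 2 ^ e
    length≤n*2^e {L} L! counted with maximal-cover counted
    ... | Ms , Ms! , Ms-maximal , covered = begin
      length L            ≤⟨ length-≤-cover (λ M → _⊆? M ∩ ∁ B) Ms L
                               (All.map (λ M-maximal → counted-in-maximal M-maximal L! counted) Ms-maximal) covered ⟩
      length Ms * 2 ^ e   ≤⟨ *-monoˡ-≤ (2 ^ e) (maximal-family-bound Ms! Ms-maximal) ⟩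
      n * 2 ^ e           ∎
      where open ≤-Reasoning

lemma4p2 : (n : ℕ) (G : FinAbGroup n) (B : Subset n) → IsIndexTwoSubgroup G B →
           (L : List (Subset n)) → Unique L → All (Counted G B) L →
           length L ^ 8 ≤ (n ^ 8) * (2 ^ (n + 4 * ∣ A₂∖ G B ∣))
lemma4p2 n G B B-index-two L L! counted = begin
  length L ^ 8                ≤⟨ ^-monoˡ-≤ 8 (length≤n*2^e L! counted) ⟩
  (n * 2 ^ e) ^ 8             ≡⟨ ^-distribʳ-* n (2 ^ e) 8 ⟩
  n ^ 8 * (2 ^ e) ^ 8         ≡⟨ cong (n ^ 8 *_) (^-*-assoc 2 e 8) ⟩
  n ^ 8 * 2 ^ (e * 8)         ≤⟨ *-monoʳ-≤ (n ^ 8) (^-monoʳ-≤ 2 (m/n*n≤m (n + 4 * k) 8)) ⟩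
  n ^ 8 * 2 ^ (n + 4 * k)     ∎
  where
  open ≤-Reasoning
  open FiniteAbelianGroup.Counting G B-index-two
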